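{- Let $k$ be a positive integer, $n\geq 5$, and let $r$ be an integer with $0\leq r\leq 4^k$ and $r\neq 4^k-1$. Then there is a decomposition of $\overrightarrow{C}_{(4^k:n)}$ into $r$ $\overrightarrow{C}_n$-factors and $s=4^k-r$ $\overrightarrow{C}_{n\cdot 2^k}$-factors.
   Context: $\overrightarrow{C}_{(h:n)}$ is the directed graph with $n$ parts $G_0,\dots,G_{n-1}$, each of size $h$, with an arc from every vertex of $G_i$ to every vertex of $G_{i+1}$ (indices mod $n$). A $\overrightarrow{C}_\ell$-factor is a spanning subgraph that is a vertex-disjoint union of directed cycles of length $\ell$; a decomposition is a partition of the arc set into spanning subgraphs. -}

module Defs where

open import Data.Nat using (ℕ; zero; suc; _<_)
open import Data.Fin using (Fin; toℕ)
open import Data.Product using (Σ; _×_)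
open import Data.Sum using (_⊎_)
open import Relation.Binary.PropositionalEquality using (_≡_; _≢_)
open import Function.Bundles using (_↔_; Inverse)

-- Vertices of C_(h:n): a vertex (i , a) is vertex a of part G_i.
Vertex : ℕ → ℕ → Set
Vertex n h = Fin n × Fin h

-- Arc relation of C_(h:n): from every vertex of G_i to every vertex of G_{i+1 mod n}.
Arc : {n h : ℕ} → Vertex n h → Vertex n h → Set
Arc {n} (i Data.Product., _) (j Data.Product., _) =
  (suc (toℕ i) ≡ toℕ j) ⊎ ((suc (toℕ i) ≡ n) × (toℕ j ≡ 0))

iter : {A : Set} → ℕ → (A → A) → A → A
iter zero    f x = x
iter (suc m) f x = f (iter m f x)

-- A spanning subgraph in which every vertex has out- and in-degree one is
-- the same as a permutation σ (arc v → σ v); it is a disjoint union of directed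
-- cycles of length ℓ iff every orbit of σ has size exactly ℓ.
record CycleFactor (n h ℓ : ℕ) : Set where
  field
    σ       : Vertex n h ↔ Vertex n h
    isArc   : ∀ v → Arc v (Inverse.to σ v)
    closes  : ∀ v → iter ℓ (Inverse.to σ) v ≡ v
    minimal : ∀ v (j : ℕ) → 0 < j → j < ℓ → iter j (Inverse.to σ) v ≢ v

open CycleFactor public

next : {n h ℓ : ℕ} → CycleFactor n h ℓ → Vertex n h → Vertex n h
next F = Inverse.to (σ F)

IsDecomposition : {n h m : ℕ} (len : Fin m → ℕ) → ((j : Fin m) → CycleFactor n h (len j)) → Set
IsDecomposition {n} {h} {m} len F =
  ∀ (u v : Vertex n h) → Arc u v →
    Σ (Fin m) (λ j → (next (F j) u ≡ v) × (∀ j' → next (F j') u ≡ v → j' ≡ j))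

module Submission where

-- The proof is a voltage construction.  Give the labels Fin h, h = q², q = 2^k,
-- the structure of the group (ℤ/q)².  A voltage c : Fin n → Fin h yields the
-- permutation (i , a) ↦ (i + 1 , a + c i) of the vertices, which uses only arcs
-- of C_(h:n) and whose cycles all have length n · ord(c 0 + ⋯ + c (n-1))
-- (module Voltage).  Choosing h voltages c_j such that every column j ↦ c_j i is
-- a bijection, the h permutations partition the arcs.  The columns used are
-- g, -(g ∘ τ), then pairs (g, -g) closed by (g, ψ g, ψ² g) when n is odd, where
-- g is a translation of ℤ/h, ψ an automorphism of order three of (ℤ/q)², and τ
-- fixes the r labels j < r and moves every other label to a neighbour (except
-- r + 2 ↦ r when h - r is odd).  The total voltage g j - g (τ j) is then 0
-- for j < r and has an odd coordinate otherwise; in (ℤ/q)² the latter elements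
-- have order exactly q.

open import Defs
open import Level using (0ℓ)
open import Algebra.Bundles using (AbelianGroup)
open import Algebra.Structures using (IsAbelianGroup)
open import Data.Nat
  using (ℕ; zero; suc; _+_; _*_; _^_; _∸_; _%_; _/_; _<_; _≤_; NonZero; >-nonZero; >-nonZero⁻¹; z<s; s<s; s≤s)
open import Data.Nat.Properties
  using (_<?_; +-comm; +-assoc; +-identityʳ; +-suc; *-comm; *-assoc; *-identityˡ; <⇒≤; <⇒≱; ≮⇒≥; ≤-antisym;
         <-trans; <-≤-trans; m≤m+n; m+n≮m; +-monoʳ-<; +-cancelˡ-<; *-monoʳ-≤; *-cancelʳ-<; ∸-monoʳ-<;
         m+[n∸m]≡n; m+n∸m≡n; m+n∸n≡m; m∸n+n≡m; m<m*n; m*n≢0; m^n≢0; m^n>0; ^-*-assoc; ^-distribˡ-+-*)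
open import Data.Nat.DivMod
  using (_mod_; m%n<n; m<n⇒m%n≡m; n%n≡0; m*n%n≡0; [m+n]%n≡m%n; m%n%n≡m%n; %-distribˡ-+; %-remove-+ˡ;
         m∣n⇒o%n%m≡o%m; m<n⇒m/n≡0; n/n≡1; m*n/n≡m; +-distrib-/-∣ˡ)
open import Data.Nat.Divisibility using (_∣_; divides; ∣-trans; m∣m*n; n∣m⇒m%n≡0; m%n≡0⇒n∣m; *-monoʳ-∣; *-cancelˡ-∣; 1∣_; ∣⇒≤)
open import Data.Nat.Primality using (euclidsLemma; prime[2])
open import Data.Nat.Tactic.RingSolver using (solve-∀)
open import Data.Fin using (Fin; toℕ; fromℕ<; combine)
open import Data.Fin.Properties using (toℕ-injective; toℕ<n; toℕ-fromℕ<; *↔×; toℕ-combine)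
open import Data.Product using (Σ; _×_; _,_; proj₁; proj₂; uncurry)
open import Data.Sum using (_⊎_; inj₁; inj₂; [_,_]′)
open import Data.Empty using (⊥-elim)
open import Data.Bool using (if_then_else_)
open import Function using (_∘_)
open import Function.Bundles using (_↔_; Inverse; mk↔ₛ′)
open import Function.Construct.Composition using (_↔-∘_)
open import Relation.Nullary using (¬_; yes; no; contradiction)
open import Relation.Nullary.Decidable using (⌊_⌋)
open import Relation.Binary.PropositionalEquality
open ≡-Reasoning

-- An abelian group structure on A whose equality is propositional equality,
-- so that group identities can be used directly in statements about
-- permutations of a finite set.
record AbGroupOn (A : Set) : Set where
  infixl 6 _∙_
  field
    _∙_            : A → A → A
    ε              : A
    _⁻¹            : A → A
    isAbelianGroup : IsAbelianGroup _≡_ _∙_ ε _⁻¹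

  abelianGroup : AbelianGroup 0ℓ 0ℓ
  abelianGroup = record { isAbelianGroup = isAbelianGroup }

-- The group axioms with identity and inverse on one side only suffice
-- in the commutative case.
mkAbGroupOn : {A : Set} (_∙_ : A → A → A) (ε : A) (_⁻¹ : A → A) →
  (∀ x y z → (x ∙ y) ∙ z ≡ x ∙ (y ∙ z)) → (∀ x y → x ∙ y ≡ y ∙ x) →
  (∀ x → x ∙ ε ≡ x) → (∀ x → x ∙ (x ⁻¹) ≡ ε) → AbGroupOn A
mkAbGroupOn _∙_ ε _⁻¹ assoc comm idʳ invʳ = record
  { _∙_ = _∙_ ; ε = ε ; _⁻¹ = _⁻¹
  ; isAbelianGroup = record
    { isGroup = record
      { isMonoid = record
        { isSemigroup = record
          { isMagma = record { isEquivalence = isEquivalence ; ∙-cong = cong₂ _∙_ }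
          ; assoc = assoc }
        ; identity = (λ x → trans (comm ε x) (idʳ x)) , idʳ }
      ; inverse = (λ x → trans (comm (x ⁻¹) x) (invʳ x)) , invʳ
      ; ⁻¹-cong = cong _⁻¹ }
    ; comm = comm } }

module AbGroupFacts {A : Set} (G : AbGroupOn A) where
  open AbGroupOn G public using (abelianGroup)
  open AbelianGroup abelianGroup public
    using (_∙_; ε; _⁻¹; assoc; comm; identityˡ; identityʳ; inverseˡ; inverseʳ)
  open import Algebra.Properties.AbelianGroup abelianGroup public
  open import Algebra.Properties.Monoid.Mult (AbelianGroup.monoid abelianGroup) public
    using () renaming (_×_ to _·_)

  HasOrder : ℕ → A → Set
  HasOrder L x = (L · x ≡ ε) × (∀ t → 0 < t → t < L → t · x ≢ ε)

  translation : A → A ↔ A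
  translation c = mk↔ₛ′ (_∙ c) (_∙ c ⁻¹) (//-rightDividesˡ c) (//-rightDividesʳ c)

  negation : A ↔ A
  negation = mk↔ₛ′ _⁻¹ _⁻¹ ⁻¹-involutive ⁻¹-involutive

  Σ< : (ℕ → A) → ℕ → A
  Σ< f zero    = ε
  Σ< f (suc t) = f 0 ∙ Σ< (f ∘ suc) t

  Σ<-+ : ∀ f a b → Σ< f (a + b) ≡ Σ< f a ∙ Σ< (λ u → f (a + u)) b
  Σ<-+ f zero    b = sym (identityˡ _)
  Σ<-+ f (suc a) b = trans (cong (f 0 ∙_) (Σ<-+ (f ∘ suc) a b)) (sym (assoc _ _ _))

  Σ<-cong : ∀ {f g} t → (∀ u → u < t → f u ≡ g u) → Σ< f t ≡ Σ< g t
  Σ<-cong zero    _  = refl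
  Σ<-cong (suc t) eq = cong₂ _∙_ (eq 0 z<s) (Σ<-cong t (λ u u<t → eq (suc u) (s<s u<t)))

Odd : ℕ → Set
Odd x = x % 2 ≡ 1

suc-flips-parity : ∀ m → suc m % 2 ≢ m % 2
suc-flips-parity zero    ()
suc-flips-parity (suc m) eq = suc-flips-parity m (trans (sym eq) ss%2)
  where
    ss%2 : suc (suc m) % 2 ≡ m % 2
    ss%2 = trans (cong (_% 2) (+-comm 2 m)) ([m+n]%n≡m%n m 2)

odd-difference : ∀ d a b → (d + b) % 2 ≡ a % 2 → a % 2 ≢ b % 2 → Odd d
odd-difference d a b d+b≡a a≢b with d % 2 in d%2≡ | m%n<n d 2
... | 0           | _ = contradiction (begin
      a % 2                 ≡⟨ d+b≡a ⟨
      (d + b) % 2           ≡⟨ %-distribˡ-+ d b 2 ⟩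
      (d % 2 + b % 2) % 2   ≡⟨ cong (λ e → (e + b % 2) % 2) d%2≡ ⟩
      b % 2 % 2             ≡⟨ m%n%n≡m%n b 2 ⟩
      b % 2                 ∎) a≢b
... | 1           | _ = refl
... | suc (suc _) | s<s (s<s ())

2^k∣t*odd⇒2^k∣t : ∀ k {t x} → Odd x → 2 ^ k ∣ t * x → 2 ^ k ∣ t
2^k∣t*odd⇒2^k∣t zero    {t} _     _   = 1∣ t
2^k∣t*odd⇒2^k∣t (suc k) {t} {x} x-odd 2^k+1∣tx
  with euclidsLemma t x prime[2] (∣-trans (m∣m*n (2 ^ k)) 2^k+1∣tx)
... | inj₂ 2∣x = contradiction (trans (sym x-odd) (n∣m⇒m%n≡0 x 2 2∣x)) λ ()
... | inj₁ (divides t' refl) =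
  subst (2 ^ suc k ∣_) (*-comm 2 t') (*-monoʳ-∣ 2 (2^k∣t*odd⇒2^k∣t k {t'} {x} x-odd 2^k∣t'x))
  where
    2^k∣t'x : 2 ^ k ∣ t' * x
    2^k∣t'x = *-cancelˡ-∣ 2 (subst (2 ^ suc k ∣_)
      (trans (cong (_* x) (*-comm t' 2)) (*-assoc 2 t' x)) 2^k+1∣tx)

module ZMod (N : ℕ) .{{_ : NonZero N}} where

  infixl 6 _⊕_

  ⟦_⟧ : ℕ → Fin N
  ⟦ m ⟧ = m mod N

  toℕ-⟦⟧ : ∀ m → toℕ ⟦ m ⟧ ≡ m % N
  toℕ-⟦⟧ m = toℕ-fromℕ< (m%n<n m N)

  ⟦⟧-cong : ∀ {a b} → a % N ≡ b % N → ⟦ a ⟧ ≡ ⟦ b ⟧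
  ⟦⟧-cong {a} {b} eq = toℕ-injective (trans (toℕ-⟦⟧ a) (trans eq (sym (toℕ-⟦⟧ b))))

  ⟦toℕ⟧ : ∀ (x : Fin N) → ⟦ toℕ x ⟧ ≡ x
  ⟦toℕ⟧ x = toℕ-injective (trans (toℕ-⟦⟧ (toℕ x)) (m<n⇒m%n≡m (toℕ<n x)))

  _⊕_ : Fin N → Fin N → Fin N
  x ⊕ y = ⟦ toℕ x + toℕ y ⟧

  ⊖_ : Fin N → Fin N
  ⊖ x = ⟦ N ∸ toℕ x ⟧

  𝟘 : Fin N
  𝟘 = ⟦ 0 ⟧

  -- ⟦_⟧ is a homomorphism from (ℕ, +) onto ℤ/N; the group laws follow from it.
  ⟦+⟧ : ∀ a b → ⟦ a ⟧ ⊕ ⟦ b ⟧ ≡ ⟦ a + b ⟧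
  ⟦+⟧ a b = ⟦⟧-cong (begin
    (toℕ ⟦ a ⟧ + toℕ ⟦ b ⟧) % N ≡⟨ cong₂ (λ u v → (u + v) % N) (toℕ-⟦⟧ a) (toℕ-⟦⟧ b) ⟩
    (a % N + b % N) % N         ≡⟨ %-distribˡ-+ a b N ⟨
    (a + b) % N                 ∎)

  private
    0%N≡0 : 0 % N ≡ 0
    0%N≡0 = m<n⇒m%n≡m (>-nonZero⁻¹ N)

    ⊕-assoc : ∀ x y z → (x ⊕ y) ⊕ z ≡ x ⊕ (y ⊕ z)
    ⊕-assoc x y z = begin
      ⟦ toℕ x + toℕ y ⟧ ⊕ z                 ≡⟨ cong (⟦ toℕ x + toℕ y ⟧ ⊕_) (⟦toℕ⟧ z) ⟨
      ⟦ toℕ x + toℕ y ⟧ ⊕ ⟦ toℕ z ⟧         ≡⟨ ⟦+⟧ _ _ ⟩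
      ⟦ toℕ x + toℕ y + toℕ z ⟧             ≡⟨ cong ⟦_⟧ (+-assoc (toℕ x) (toℕ y) (toℕ z)) ⟩
      ⟦ toℕ x + (toℕ y + toℕ z) ⟧           ≡⟨ ⟦+⟧ _ _ ⟨
      ⟦ toℕ x ⟧ ⊕ ⟦ toℕ y + toℕ z ⟧         ≡⟨ cong (_⊕ (y ⊕ z)) (⟦toℕ⟧ x) ⟩
      x ⊕ (y ⊕ z)                           ∎

    ⊕-identityʳ : ∀ x → x ⊕ 𝟘 ≡ x
    ⊕-identityʳ x = begin
      x ⊕ ⟦ 0 ⟧           ≡⟨ cong (_⊕ 𝟘) (⟦toℕ⟧ x) ⟨
      ⟦ toℕ x ⟧ ⊕ ⟦ 0 ⟧   ≡⟨ ⟦+⟧ (toℕ x) 0 ⟩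
      ⟦ toℕ x + 0 ⟧       ≡⟨ cong ⟦_⟧ (+-identityʳ (toℕ x)) ⟩
      ⟦ toℕ x ⟧           ≡⟨ ⟦toℕ⟧ x ⟩
      x                   ∎

    ⊕-inverseʳ : ∀ x → x ⊕ (⊖ x) ≡ 𝟘
    ⊕-inverseʳ x = begin
      x ⊕ ⟦ N ∸ toℕ x ⟧           ≡⟨ cong (_⊕ (⊖ x)) (⟦toℕ⟧ x) ⟨
      ⟦ toℕ x ⟧ ⊕ ⟦ N ∸ toℕ x ⟧   ≡⟨ ⟦+⟧ _ _ ⟩
      ⟦ toℕ x + (N ∸ toℕ x) ⟧     ≡⟨ cong ⟦_⟧ (m+[n∸m]≡n (<⇒≤ (toℕ<n x))) ⟩
      ⟦ N ⟧                       ≡⟨ ⟦⟧-cong (trans (n%n≡0 N) (sym 0%N≡0)) ⟩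
      𝟘                           ∎

  abGroup : AbGroupOn (Fin N)
  abGroup = mkAbGroupOn _⊕_ 𝟘 ⊖_ ⊕-assoc (λ x y → cong ⟦_⟧ (+-comm (toℕ x) (toℕ y)))
                        ⊕-identityʳ ⊕-inverseʳ

  open AbGroupFacts abGroup using (_·_; //-rightDividesˡ)

  ⟦m*N⟧≡𝟘 : ∀ m → ⟦ m * N ⟧ ≡ 𝟘
  ⟦m*N⟧≡𝟘 m = ⟦⟧-cong (trans (m*n%n≡0 m N) (sym 0%N≡0))

  ⟦⟧≡𝟘⇒∣ : ∀ a → ⟦ a ⟧ ≡ 𝟘 → N ∣ a
  ⟦⟧≡𝟘⇒∣ a eq = m%n≡0⇒n∣m a N (begin
    a % N        ≡⟨ toℕ-⟦⟧ a ⟨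
    toℕ ⟦ a ⟧    ≡⟨ cong toℕ eq ⟩
    toℕ ⟦ 0 ⟧    ≡⟨ toℕ-⟦⟧ 0 ⟩
    0 % N        ≡⟨ 0%N≡0 ⟩
    0            ∎)

  ·-⟦⟧ : ∀ t x → t · x ≡ ⟦ t * toℕ x ⟧
  ·-⟦⟧ zero    x = refl
  ·-⟦⟧ (suc t) x = begin
    x ⊕ t · x                       ≡⟨ cong₂ _⊕_ (⟦toℕ⟧ x) (sym (·-⟦⟧ t x)) ⟨
    ⟦ toℕ x ⟧ ⊕ ⟦ t * toℕ x ⟧       ≡⟨ ⟦+⟧ (toℕ x) (t * toℕ x) ⟩
    ⟦ toℕ x + t * toℕ x ⟧           ∎

  N·x≡𝟘 : ∀ x → N · x ≡ 𝟘
  N·x≡𝟘 x = trans (·-⟦⟧ N x) (trans (cong ⟦_⟧ (*-comm N (toℕ x))) (⟦m*N⟧≡𝟘 (toℕ x)))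

  odd-sub : 2 ∣ N → ∀ a b → toℕ a % 2 ≢ toℕ b % 2 → Odd (toℕ (a ⊕ ⊖ b))
  odd-sub 2∣N a b a≢b = odd-difference (toℕ (a ⊕ ⊖ b)) (toℕ a) (toℕ b) (begin
    (toℕ (a ⊕ ⊖ b) + toℕ b) % 2        ≡⟨ m∣n⇒o%n%m≡o%m 2 N _ 2∣N ⟨
    (toℕ (a ⊕ ⊖ b) + toℕ b) % N % 2    ≡⟨ cong (_% 2) (toℕ-⟦⟧ _) ⟨
    toℕ (a ⊕ ⊖ b ⊕ b) % 2              ≡⟨ cong (λ x → toℕ x % 2) (//-rightDividesˡ b a) ⟩
    toℕ a % 2                          ∎) a≢b

module PowerOfTwo (k : ℕ) where
  instance
    2^k≢0 : NonZero (2 ^ k)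
    2^k≢0 = m^n≢0 2 k
  open ZMod (2 ^ k)
  open AbGroupFacts abGroup using (_·_; HasOrder)

  odd⇒order : ∀ x → Odd (toℕ x) → HasOrder (2 ^ k) x
  odd⇒order x x-odd = N·x≡𝟘 x , λ t 0<t t<2^k t·x≡𝟘 →
    <⇒≱ t<2^k (∣⇒≤ {{>-nonZero 0<t}} (2^k∣t*odd⇒2^k∣t k x-odd
      (⟦⟧≡𝟘⇒∣ (t * toℕ x) (trans (sym (·-⟦⟧ t x)) t·x≡𝟘))))

iter-suc : ∀ {X : Set} (f : X → X) t x → iter (suc t) f x ≡ iter t f (f x)
iter-suc f zero    x = refl
iter-suc f (suc t) x = cong f (iter-suc f t x)

iter-+ : ∀ {X : Set} (f : X → X) a b x → iter (a + b) f x ≡ iter b f (iter a f x)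
iter-+ f zero    b x = refl
iter-+ f (suc a) b x = begin
  iter (suc (a + b)) f x   ≡⟨ iter-suc f (a + b) x ⟩
  iter (a + b) f (f x)     ≡⟨ iter-+ f a b (f x) ⟩
  iter b f (iter a f (f x)) ≡⟨ cong (iter b f) (iter-suc f a x) ⟨
  iter b f (iter (suc a) f x) ∎

module Voltage {n h : ℕ} .{{_ : NonZero n}} (G : AbGroupOn (Fin h)) where
  open AbGroupFacts G
  private
    module ℤn = ZMod n
    module ℤnG = AbGroupFacts ℤn.abGroup
  open ℤn using (⟦_⟧; _⊕_; 𝟘)

  succ : Fin n → Fin n
  succ i = i ⊕ ⟦ 1 ⟧

  toℕ-succ : ∀ i → toℕ (succ i) ≡ suc (toℕ i) % n
  toℕ-succ i = begin
    toℕ (i ⊕ ⟦ 1 ⟧)              ≡⟨ cong (λ x → toℕ (x ⊕ ⟦ 1 ⟧)) (ℤn.⟦toℕ⟧ i) ⟨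
    toℕ (⟦ toℕ i ⟧ ⊕ ⟦ 1 ⟧)      ≡⟨ cong toℕ (ℤn.⟦+⟧ (toℕ i) 1) ⟩
    toℕ ⟦ toℕ i + 1 ⟧            ≡⟨ cong (λ u → toℕ ⟦ u ⟧) (+-comm (toℕ i) 1) ⟩
    toℕ ⟦ suc (toℕ i) ⟧          ≡⟨ ℤn.toℕ-⟦⟧ (suc (toℕ i)) ⟩
    suc (toℕ i) % n              ∎

  succ-arc : ∀ i (a b : Fin h) → Arc (i , a) (succ i , b)
  succ-arc i a b with suc (toℕ i) <? n
  ... | yes i+1<n = inj₁ (sym (trans (toℕ-succ i) (m<n⇒m%n≡m i+1<n)))
  ... | no  i+1≮n = inj₂ (i+1≡n , trans (toℕ-succ i) (trans (cong (_% n) i+1≡n) (n%n≡0 n)))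
    where i+1≡n = ≤-antisym (toℕ<n i) (≮⇒≥ i+1≮n)

  arc⇒succ : ∀ {i j} (a b : Fin h) → Arc (i , a) (j , b) → j ≡ succ i
  arc⇒succ {i} {j} _ _ (inj₁ i+1≡j) = toℕ-injective (begin
    toℕ j                ≡⟨ i+1≡j ⟨
    suc (toℕ i)          ≡⟨ m<n⇒m%n≡m (subst (_< n) (sym i+1≡j) (toℕ<n j)) ⟨
    suc (toℕ i) % n      ≡⟨ toℕ-succ i ⟨
    toℕ (succ i)         ∎)
  arc⇒succ {i} {j} _ _ (inj₂ (i+1≡n , j≡0)) = toℕ-injective (begin
    toℕ j                ≡⟨ j≡0 ⟩
    0                    ≡⟨ n%n≡0 n ⟨
    n % n                ≡⟨ cong (_% n) i+1≡n ⟨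
    suc (toℕ i) % n      ≡⟨ toℕ-succ i ⟨
    toℕ (succ i)         ∎)

  iter-succ : ∀ t i → iter t succ i ≡ i ⊕ ⟦ t ⟧
  iter-succ zero    i = sym (ℤnG.identityʳ i)
  iter-succ (suc t) i = begin
    iter t succ i ⊕ ⟦ 1 ⟧   ≡⟨ cong (_⊕ ⟦ 1 ⟧) (iter-succ t i) ⟩
    i ⊕ ⟦ t ⟧ ⊕ ⟦ 1 ⟧       ≡⟨ ℤnG.assoc i ⟦ t ⟧ ⟦ 1 ⟧ ⟩
    i ⊕ (⟦ t ⟧ ⊕ ⟦ 1 ⟧)     ≡⟨ cong (i ⊕_) (ℤn.⟦+⟧ t 1) ⟩
    i ⊕ ⟦ t + 1 ⟧           ≡⟨ cong (λ u → i ⊕ ⟦ u ⟧) (+-comm t 1) ⟩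
    i ⊕ ⟦ suc t ⟧           ∎

  iter-period : ∀ m i → iter (m * n) succ i ≡ i
  iter-period m i = begin
    iter (m * n) succ i ≡⟨ iter-succ (m * n) i ⟩
    i ⊕ ⟦ m * n ⟧       ≡⟨ cong (i ⊕_) (ℤn.⟦m*N⟧≡𝟘 m) ⟩
    i ⊕ 𝟘               ≡⟨ ℤnG.identityʳ i ⟩
    i                   ∎

  iter-round : ∀ i → iter n succ i ≡ i
  iter-round i = subst (λ t → iter t succ i ≡ i) (*-identityˡ n) (iter-period 1 i)

  iter-return : ∀ t i → iter t succ i ≡ i → n ∣ t
  iter-return t i eq = ℤn.⟦⟧≡𝟘⇒∣ t (ℤnG.∙-cancelˡ i ⟦ t ⟧ 𝟘 (begin
    i ⊕ ⟦ t ⟧     ≡⟨ iter-succ t i ⟨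
    iter t succ i ≡⟨ eq ⟩
    i             ≡⟨ ℤnG.identityʳ i ⟨
    i ⊕ 𝟘         ∎))

  walk : (Fin n → Fin h) → Vertex n h → Vertex n h
  walk c (i , a) = succ i , a ∙ c i

  walkInverse : (Fin n → Fin h) → Vertex n h ↔ Vertex n h
  walkInverse c = mk↔ₛ′ (walk c) back
    (λ (i , b) → cong₂ _,_ (ℤnG.//-rightDividesˡ ⟦ 1 ⟧ i) (//-rightDividesˡ (c (pred i)) b))
    (λ (i , a) → cong₂ _,_ (pred-succ i)
       (trans (cong (λ j → a ∙ c i ∙ c j ⁻¹) (pred-succ i)) (//-rightDividesʳ (c i) a)))
    where
      pred : Fin n → Fin n
      pred i = i ⊕ ℤn.⊖ ⟦ 1 ⟧
      pred-succ : ∀ i → pred (succ i) ≡ i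
      pred-succ i = ℤnG.//-rightDividesʳ ⟦ 1 ⟧ i
      back : Vertex n h → Vertex n h
      back (i , b) = pred i , b ∙ c (pred i) ⁻¹

  gain : (Fin n → Fin h) → Fin n → ℕ → Fin h
  gain c i t = Σ< (λ u → c (iter u succ i)) t

  total : (Fin n → Fin h) → Fin h
  total c = gain c 𝟘 n

  gain-suc : ∀ c i t → gain c i (suc t) ≡ c i ∙ gain c (succ i) t
  gain-suc c i t = cong (c i ∙_) (Σ<-cong t (λ u _ → cong c (iter-suc succ u i)))

  gain-+ : ∀ c i a b → gain c i (a + b) ≡ gain c i a ∙ gain c (iter a succ i) b
  gain-+ c i a b = trans (Σ<-+ _ a b)
    (cong (gain c i a ∙_) (Σ<-cong b (λ u _ → cong c (iter-+ succ a u i))))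

  iter-walk : ∀ c t i a → iter t (walk c) (i , a) ≡ (iter t succ i , a ∙ gain c i t)
  iter-walk c zero    i a = cong (i ,_) (sym (identityʳ a))
  iter-walk c (suc t) i a = begin
    iter (suc t) (walk c) (i , a)                         ≡⟨ iter-suc (walk c) t (i , a) ⟩
    iter t (walk c) (succ i , a ∙ c i)                    ≡⟨ iter-walk c t (succ i) (a ∙ c i) ⟩
    (iter t succ (succ i) , a ∙ c i ∙ gain c (succ i) t)  ≡⟨ cong (_, a ∙ c i ∙ gain c (succ i) t) (iter-suc succ t i) ⟨
    (iter (suc t) succ i , a ∙ c i ∙ gain c (succ i) t)   ≡⟨ cong (iter (suc t) succ i ,_)
                                                               (trans (assoc _ _ _) (cong (a ∙_) (sym (gain-suc c i t)))) ⟩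
    (iter (suc t) succ i , a ∙ gain c i (suc t))          ∎

  gain-rotate : ∀ c i → gain c i n ≡ gain c (succ i) n
  gain-rotate c i = ∙-cancelʳ (c i) _ _ (begin
    gain c i n ∙ c i                                ≡⟨ cong (λ j → gain c i n ∙ c j) (iter-round i) ⟨
    gain c i n ∙ c (iter n succ i)                  ≡⟨ cong (gain c i n ∙_) (identityʳ _) ⟨
    gain c i n ∙ gain c (iter n succ i) 1           ≡⟨ gain-+ c i n 1 ⟨
    gain c i (n + 1)                                ≡⟨ cong (gain c i) (+-comm n 1) ⟩
    gain c i (suc n)                                ≡⟨ gain-suc c i n ⟩
    c i ∙ gain c (succ i) n                         ≡⟨ comm _ _ ⟩
    gain c (succ i) n ∙ c i                         ∎)

  gain-round : ∀ c i → gain c i n ≡ total c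
  gain-round c i = begin
    gain c i n                       ≡⟨ cong (λ j → gain c j n) (ℤn.⟦toℕ⟧ i) ⟨
    gain c ⟦ toℕ i ⟧ n               ≡⟨ cong (λ j → gain c j n) (ℤnG.identityˡ _) ⟨
    gain c (𝟘 ⊕ ⟦ toℕ i ⟧) n         ≡⟨ cong (λ j → gain c j n) (iter-succ (toℕ i) 𝟘) ⟨
    gain c (iter (toℕ i) succ 𝟘) n   ≡⟨ from-𝟘 (toℕ i) ⟩
    total c                          ∎
    where
      from-𝟘 : ∀ t → gain c (iter t succ 𝟘) n ≡ total c
      from-𝟘 zero    = refl
      from-𝟘 (suc t) = trans (sym (gain-rotate c (iter t succ 𝟘))) (from-𝟘 t)

  gain-multiple : ∀ c i m → gain c i (m * n) ≡ m · total c
  gain-multiple c i zero    = refl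
  gain-multiple c i (suc m) = begin
    gain c i (n + m * n)                            ≡⟨ gain-+ c i n (m * n) ⟩
    gain c i n ∙ gain c (iter n succ i) (m * n)     ≡⟨ cong₂ (λ x j → x ∙ gain c j (m * n)) (gain-round c i) (iter-round i) ⟩
    total c ∙ gain c i (m * n)                      ≡⟨ cong (total c ∙_) (gain-multiple c i m) ⟩
    total c ∙ m · total c                           ∎

  voltageFactor : (c : Fin n → Fin h) {ℓ L : ℕ} → ℓ ≡ L * n → HasOrder L (total c) →
                  CycleFactor n h ℓ
  voltageFactor c {ℓ} {L} ℓ≡Ln (L·D≡ε , below-L) = record
    { σ       = walkInverse c
    ; isArc   = λ (i , a) → succ-arc i a (a ∙ c i)
    ; closes  = λ v → subst (λ t → iter t (walk c) v ≡ v) (sym ℓ≡Ln) (closes-Ln v)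
    ; minimal = λ v t 0<t t<ℓ → no-early-return v t 0<t (subst (t <_) ℓ≡Ln t<ℓ) }
    where
      closes-Ln : ∀ v → iter (L * n) (walk c) v ≡ v
      closes-Ln (i , a) = begin
        iter (L * n) (walk c) (i , a)                ≡⟨ iter-walk c (L * n) i a ⟩
        (iter (L * n) succ i , a ∙ gain c i (L * n)) ≡⟨ cong₂ (λ j x → j , a ∙ x) (iter-period L i)
                                                         (trans (gain-multiple c i L) L·D≡ε) ⟩
        (i , a ∙ ε)                                  ≡⟨ cong (i ,_) (identityʳ a) ⟩
        (i , a)                                      ∎

      no-early-return : ∀ v t → 0 < t → t < L * n → iter t (walk c) v ≢ v
      no-early-return (i , a) t 0<t t<Ln returns
        with iter-return t i (cong proj₁ (trans (sym (iter-walk c t i a)) returns))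
      ... | divides (suc m) refl = below-L (suc m) z<s (*-cancelʳ-< n (suc m) L t<Ln)
        (trans (sym (gain-multiple c i (suc m)))
               (∙-cancelˡ a _ _ (trans (cong proj₂ (trans (sym (iter-walk c t i a)) returns)) (sym (identityʳ a)))))

  voltageDecomposition : (column : Fin n → Fin h ↔ Fin h) (len L : Fin h → ℕ) →
    (∀ j → len j ≡ L j * n) → (∀ j → HasOrder (L j) (total (λ i → Inverse.to (column i) j))) →
    Σ ((j : Fin h) → CycleFactor n h (len j)) (IsDecomposition len)
  voltageDecomposition column len L len≡ order = factor , decomposes
    where
      voltage : Fin h → Fin n → Fin h
      voltage j i = Inverse.to (column i) j

      factor : (j : Fin h) → CycleFactor n h (len j)
      factor j = voltageFactor (voltage j) (len≡ j) (order j)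

      decomposes : IsDecomposition len factor
      decomposes (i , a) (i' , b) arc = j , reaches , unique
        where
          j : Fin h
          j = Inverse.from (column i) (a ⁻¹ ∙ b)
          reaches : walk (voltage j) (i , a) ≡ (i' , b)
          reaches = cong₂ _,_ (sym (arc⇒succ a b arc))
            (trans (cong (a ∙_) (Inverse.strictlyInverseˡ (column i) (a ⁻¹ ∙ b))) (\\-leftDividesˡ a b))
          unique : ∀ j' → walk (voltage j') (i , a) ≡ (i' , b) → j' ≡ j
          unique j' reaches' = trans (sym (Inverse.strictlyInverseʳ (column i) j'))
            (cong (Inverse.from (column i)) (y≈x\\z a _ b (cong proj₂ reaches')))

  total-Σ : ∀ (f : ℕ → Fin h) → total (f ∘ toℕ) ≡ Σ< f n
  total-Σ f = Σ<-cong n (λ u u<n → cong f (begin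
    toℕ (iter u succ 𝟘)  ≡⟨ cong toℕ (trans (iter-succ u 𝟘) (ℤnG.identityˡ ⟦ u ⟧)) ⟩
    toℕ ⟦ u ⟧            ≡⟨ ℤn.toℕ-⟦⟧ u ⟩
    u % n                ≡⟨ m<n⇒m%n≡m u<n ⟩
    u                    ∎))

module Product {A B : Set} (GA : AbGroupOn A) (GB : AbGroupOn B) where
  private
    module A = AbGroupFacts GA
    module B = AbGroupFacts GB

  group : AbGroupOn (A × B)
  group = mkAbGroupOn
    (λ p p' → proj₁ p A.∙ proj₁ p' , proj₂ p B.∙ proj₂ p') (A.ε , B.ε)
    (λ p → proj₁ p A.⁻¹ , proj₂ p B.⁻¹)
    (λ _ _ _ → cong₂ _,_ (A.assoc _ _ _) (B.assoc _ _ _))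
    (λ _ _ → cong₂ _,_ (A.comm _ _) (B.comm _ _))
    (λ _ → cong₂ _,_ (A.identityʳ _) (B.identityʳ _))
    (λ _ → cong₂ _,_ (A.inverseʳ _) (B.inverseʳ _))

  open AbGroupFacts group using (_·_)

  ·-pair : ∀ t x y → t · (x , y) ≡ (t A.· x , t B.· y)
  ·-pair zero    x y = refl
  ·-pair (suc t) x y = cong (λ p → x A.∙ proj₁ p , y B.∙ proj₂ p) (·-pair t x y)

module Transport {A B : Set} (GB : AbGroupOn B) (φ : A ↔ B) where
  open Inverse φ using (to; from; strictlyInverseˡ; strictlyInverseʳ)
  private module B = AbGroupFacts GB

  -- The operations are kept opaque: the structure is only used through the
  -- homomorphism equations to-∙, to-⁻¹, to-ε, which keeps unfolding cheap.
  opaque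
    group : AbGroupOn A
    group = mkAbGroupOn (λ x y → from (to x B.∙ to y)) (from B.ε) (λ x → from (to x B.⁻¹))
      (λ x y z → cong from (begin
        to (from (to x B.∙ to y)) B.∙ to z ≡⟨ cong (B._∙ to z) (strictlyInverseˡ _) ⟩
        to x B.∙ to y B.∙ to z             ≡⟨ B.assoc _ _ _ ⟩
        to x B.∙ (to y B.∙ to z)           ≡⟨ cong (to x B.∙_) (strictlyInverseˡ _) ⟨
        to x B.∙ to (from (to y B.∙ to z)) ∎))
      (λ x y → cong from (B.comm _ _))
      (λ x → trans (cong from (trans (cong (to x B.∙_) (strictlyInverseˡ _)) (B.identityʳ _)))
                   (strictlyInverseʳ x))
      (λ x → cong from (trans (cong (to x B.∙_) (strictlyInverseˡ _)) (B.inverseʳ _)))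

  open AbGroupFacts group

  opaque
    unfolding group

    to-∙ : ∀ x y → to (x ∙ y) ≡ to x B.∙ to y
    to-∙ x y = strictlyInverseˡ _

    to-⁻¹ : ∀ x → to (x ⁻¹) ≡ to x B.⁻¹
    to-⁻¹ x = strictlyInverseˡ _

    to-ε : to ε ≡ B.ε
    to-ε = strictlyInverseˡ _

  to-· : ∀ t x → to (t · x) ≡ t B.· to x
  to-· zero    x = to-ε
  to-· (suc t) x = trans (to-∙ x (t · x)) (cong (to x B.∙_) (to-· t x))

  to-injective : ∀ {y z} → to y ≡ to z → y ≡ z
  to-injective {y} {z} eq = trans (sym (strictlyInverseʳ y)) (trans (cong from eq) (strictlyInverseʳ z))

  order← : ∀ {L x} → B.HasOrder L (to x) → HasOrder L x
  order← {L} {x} (L·x≡ε , below-L) =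
    to-injective (trans (to-· L x) (trans L·x≡ε (sym to-ε))) ,
    λ t 0<t t<L t·x≡ε → below-L t 0<t t<L (trans (sym (to-· t x)) (trans (cong to t·x≡ε) to-ε))

-- On G × G the map ψ (x , y) = (-y , x - y) satisfies ψ³ = id and
-- p + ψ p + ψ² p = 0; it supplies three bijective columns summing to zero.
module Rotation {A : Set} (G : AbGroupOn A) where
  open AbGroupFacts G
  private module G² = AbGroupFacts (Product.group G G)

  ψ : A × A → A × A
  ψ (x , y) = y ⁻¹ , x ∙ y ⁻¹

  ψ² : ∀ x y → ψ (ψ (x , y)) ≡ (y ∙ x ⁻¹ , x ⁻¹)
  ψ² x y = cong₂ _,_ (⁻¹-anti-homo‿- x y)
    (trans (cong (y ⁻¹ ∙_) (⁻¹-anti-homo‿- x y)) (\\-leftDividesʳ y (x ⁻¹)))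

  ψ³ : ∀ p → ψ (ψ (ψ p)) ≡ p
  ψ³ (x , y) = trans (cong ψ (ψ² x y)) (cong₂ _,_ (⁻¹-involutive x)
    (trans (cong (y ∙ x ⁻¹ ∙_) (⁻¹-involutive x)) (//-rightDividesˡ x y)))

  ψ-sum : ∀ p → p G².∙ (ψ p G².∙ ψ (ψ p)) ≡ G².ε
  ψ-sum (x , y) = trans (cong (λ p → (x , y) G².∙ (ψ (x , y) G².∙ p)) (ψ² x y)) (cong₂ _,_
    (trans (cong (x ∙_) (\\-leftDividesʳ y (x ⁻¹))) (inverseʳ x))
    (trans (cong (y ∙_) (xyx⁻¹≈y x (y ⁻¹))) (inverseʳ y)))

-- The group (ℤ/q)² with q = 2^(k+1), carried by Fin (q · q) through the
-- coordinates u = q · x + y.  An element with an odd coordinate has order q.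
module Coordinates (k : ℕ) where
  q : ℕ
  q = 2 ^ suc k

  instance
    q≢0 : NonZero q
    q≢0 = m^n≢0 2 (suc k)

  2∣q : 2 ∣ q
  2∣q = m∣m*n (2 ^ k)

  module ℤq = ZMod q
  private
    module ℤqG = AbGroupFacts ℤq.abGroup
    module ℤq² = Product ℤq.abGroup ℤq.abGroup
    module ℤq²G = AbGroupFacts ℤq².group

  coordinates : Fin (q * q) ↔ (Fin q × Fin q)
  coordinates = *↔×

  open Inverse coordinates using () renaming (to to coords; from to point)
  module T = Transport ℤq².group coordinates

  𝔾 : AbGroupOn (Fin (q * q))
  𝔾 = T.group
  open AbGroupFacts 𝔾

  x-of y-of : Fin (q * q) → ℕ
  x-of u = toℕ (proj₁ (coords u))
  y-of u = toℕ (proj₂ (coords u))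

  toℕ-coords : ∀ u → toℕ u ≡ q * x-of u + y-of u
  toℕ-coords u = begin
    toℕ u                                   ≡⟨ cong toℕ (Inverse.strictlyInverseʳ coordinates u) ⟨
    toℕ (uncurry combine (coords u))        ≡⟨ toℕ-combine (proj₁ (coords u)) (proj₂ (coords u)) ⟩
    q * x-of u + y-of u                     ∎

  y-parity : ∀ u → y-of u % 2 ≡ toℕ u % 2
  y-parity u = sym (trans (cong (_% 2) (toℕ-coords u))
                          (%-remove-+ˡ (y-of u) (∣-trans 2∣q (m∣m*n (x-of u)))))

  x-quotient : ∀ u → x-of u ≡ toℕ u / q
  x-quotient u = sym (begin
    toℕ u / q                          ≡⟨ cong (_/ q) (toℕ-coords u) ⟩
    (q * x-of u + y-of u) / q          ≡⟨ +-distrib-/-∣ˡ (y-of u) (m∣m*n (x-of u)) ⟩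
    q * x-of u / q + y-of u / q        ≡⟨ cong₂ _+_ (trans (cong (_/ q) (*-comm q (x-of u))) (m*n/n≡m (x-of u) q))
                                                    (m<n⇒m/n≡0 (toℕ<n (proj₂ (coords u)))) ⟩
    x-of u + 0                         ≡⟨ +-identityʳ (x-of u) ⟩
    x-of u                             ∎)

  OddCoordinate : Fin (q * q) → Set
  OddCoordinate u = Odd (x-of u) ⊎ Odd (y-of u)

  oddCoordinate⇒order : ∀ u → OddCoordinate u → HasOrder q u
  oddCoordinate⇒order u odd = T.order← (pair-order (coords u) odd)
    where
      open PowerOfTwo (suc k) using (odd⇒order)
      pair-order : ∀ p → Odd (toℕ (proj₁ p)) ⊎ Odd (toℕ (proj₂ p)) → ℤq²G.HasOrder q p
      pair-order (x , y) odd = trans (ℤq².·-pair q x y) (cong₂ _,_ (ℤq.N·x≡𝟘 x) (ℤq.N·x≡𝟘 y)) ,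
        λ t 0<t t<q t·p≡ε → component odd t 0<t t<q (trans (sym (ℤq².·-pair t x y)) t·p≡ε)
        where
          component : Odd (toℕ x) ⊎ Odd (toℕ y) → ∀ t → 0 < t → t < q →
                      (t ℤqG.· x , t ℤqG.· y) ≢ (ℤq.𝟘 , ℤq.𝟘)
          component (inj₁ x-odd) t 0<t t<q eq = proj₂ (odd⇒order x x-odd) t 0<t t<q (cong proj₁ eq)
          component (inj₂ y-odd) t 0<t t<q eq = proj₂ (odd⇒order y y-odd) t 0<t t<q (cong proj₂ eq)

  coords-sub : ∀ a b → coords (a ∙ b ⁻¹) ≡
    (proj₁ (coords a) ℤq.⊕ ℤq.⊖ proj₁ (coords b) , proj₂ (coords a) ℤq.⊕ ℤq.⊖ proj₂ (coords b))
  coords-sub a b = trans (T.to-∙ a (b ⁻¹)) (cong (coords a ℤq²G.∙_) (T.to-⁻¹ b))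

  parity-differs : ∀ a b → toℕ a % 2 ≢ toℕ b % 2 → OddCoordinate (a ∙ b ⁻¹)
  parity-differs a b a≢b = inj₂ (subst (λ p → Odd (toℕ (proj₂ p))) (sym (coords-sub a b))
    (ℤq.odd-sub 2∣q (proj₂ (coords a)) (proj₂ (coords b)) (λ eq → a≢b (trans (sym (y-parity a)) (trans eq (y-parity b))))))

  x-parity-differs : ∀ a b → x-of a % 2 ≢ x-of b % 2 → OddCoordinate (a ∙ b ⁻¹)
  x-parity-differs a b a≢b = inj₁ (subst (λ p → Odd (toℕ (proj₁ p))) (sym (coords-sub a b))
    (ℤq.odd-sub 2∣q (proj₁ (coords a)) (proj₁ (coords b)) a≢b))

  private module R = Rotation ℤq.abGroup

  ψ̂ : Fin (q * q) → Fin (q * q)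
  ψ̂ u = point (R.ψ (coords u))

  coords-ψ̂ : ∀ u → coords (ψ̂ u) ≡ R.ψ (coords u)
  coords-ψ̂ u = Inverse.strictlyInverseˡ coordinates _

  ψ̂³ : ∀ u → ψ̂ (ψ̂ (ψ̂ u)) ≡ u
  ψ̂³ u = begin
    point (R.ψ (coords (ψ̂ (ψ̂ u))))     ≡⟨ cong (point ∘ R.ψ) (trans (coords-ψ̂ (ψ̂ u)) (cong R.ψ (coords-ψ̂ u))) ⟩
    point (R.ψ (R.ψ (R.ψ (coords u))))  ≡⟨ cong point (R.ψ³ (coords u)) ⟩
    point (coords u)                    ≡⟨ Inverse.strictlyInverseʳ coordinates u ⟩
    u                                   ∎

  ψ̂-bijection : Fin (q * q) ↔ Fin (q * q)
  ψ̂-bijection = mk↔ₛ′ ψ̂ (ψ̂ ∘ ψ̂) ψ̂³ ψ̂³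

  ψ̂-sum : ∀ u → u ∙ (ψ̂ u ∙ ψ̂ (ψ̂ u)) ≡ ε
  ψ̂-sum u = T.to-injective (begin
    coords (u ∙ (ψ̂ u ∙ ψ̂ (ψ̂ u)))                                 ≡⟨ T.to-∙ u _ ⟩
    coords u ℤq²G.∙ coords (ψ̂ u ∙ ψ̂ (ψ̂ u))                       ≡⟨ cong (coords u ℤq²G.∙_) (T.to-∙ (ψ̂ u) _) ⟩
    coords u ℤq²G.∙ (coords (ψ̂ u) ℤq²G.∙ coords (ψ̂ (ψ̂ u)))      ≡⟨ cong₂ (λ p p' → coords u ℤq²G.∙ (p ℤq²G.∙ p'))
                                                                         (coords-ψ̂ u) (trans (coords-ψ̂ (ψ̂ u)) (cong R.ψ (coords-ψ̂ u))) ⟩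
    coords u ℤq²G.∙ (R.ψ (coords u) ℤq²G.∙ R.ψ (R.ψ (coords u)))  ≡⟨ R.ψ-sum (coords u) ⟩
    ℤq²G.ε                                                         ≡⟨ T.to-ε ⟨
    coords ε                                                       ∎)

record PermBelow (N : ℕ) : Set where
  field
    π π⁻¹ : ℕ → ℕ
    π-π⁻¹ : ∀ u → π (π⁻¹ u) ≡ u
    π⁻¹-π : ∀ u → π⁻¹ (π u) ≡ u
    π-<   : ∀ {u} → u < N → π u < N
    π⁻¹-< : ∀ {u} → u < N → π⁻¹ u < N

  onFin : Fin N ↔ Fin N
  onFin = mk↔ₛ′ (restrict π π-<) (restrict π⁻¹ π⁻¹-<)
                (restrict-inverse π π-< π⁻¹ π⁻¹-< π-π⁻¹) (restrict-inverse π⁻¹ π⁻¹-< π π-< π⁻¹-π)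
    where
      Bounded : (ℕ → ℕ) → Set
      Bounded f = ∀ {u} → u < N → f u < N
      restrict : (f : ℕ → ℕ) → Bounded f → Fin N → Fin N
      restrict f f-< j = fromℕ< (f-< (toℕ<n j))
      restrict-inverse : ∀ f (f-< : Bounded f) g (g-< : Bounded g) → (∀ u → f (g u) ≡ u) →
                         ∀ j → restrict f f-< (restrict g g-< j) ≡ j
      restrict-inverse f _ g _ f∘g≡id j = toℕ-injective (begin
        toℕ (fromℕ< _)      ≡⟨ toℕ-fromℕ< _ ⟩
        f (toℕ (fromℕ< _))  ≡⟨ cong f (toℕ-fromℕ< _) ⟩
        f (g (toℕ j))       ≡⟨ f∘g≡id (toℕ j) ⟩
        toℕ j               ∎)

  toℕ-onFin : ∀ j → toℕ (Inverse.to onFin j) ≡ π (toℕ j)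
  toℕ-onFin j = toℕ-fromℕ< _

data Move (t u : ℕ) : Set where
  up   : u ≡ suc t → Move t u
  down : t ≡ suc u → Move t u
  wrap : t ≡ 2 → u ≡ 0 → Move t u

record Derangement (s : ℕ) : Set where
  field
    perm  : PermBelow s
    moves : ∀ t → Move t (PermBelow.π perm t)

twice : ℕ → ℕ
twice zero    = zero
twice (suc p) = suc (suc (twice p))

swapPairs : ℕ → ℕ
swapPairs zero          = 1
swapPairs (suc zero)    = 0
swapPairs (suc (suc t)) = suc (suc (swapPairs t))

swapPairs-involutive : ∀ t → swapPairs (swapPairs t) ≡ t
swapPairs-involutive zero          = refl
swapPairs-involutive (suc zero)    = refl
swapPairs-involutive (suc (suc t)) = cong (λ x → suc (suc x)) (swapPairs-involutive t)

swapPairs-< : ∀ p {t} → t < twice p → swapPairs t < twice p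
swapPairs-< (suc p) {zero}          _                 = s<s z<s
swapPairs-< (suc p) {suc zero}      _                 = z<s
swapPairs-< (suc p) {suc (suc t)}   (s<s (s<s t<2p)) = s<s (s<s (swapPairs-< p t<2p))

swapPairs-adjacent : ∀ t → swapPairs t ≡ suc t ⊎ t ≡ suc (swapPairs t)
swapPairs-adjacent zero          = inj₁ refl
swapPairs-adjacent (suc zero)    = inj₂ refl
swapPairs-adjacent (suc (suc t)) with swapPairs-adjacent t
... | inj₁ eq = inj₁ (cong (λ x → suc (suc x)) eq)
... | inj₂ eq = inj₂ (cong (λ x → suc (suc x)) eq)

rotate3 rotate3⁻¹ : ℕ → ℕ
rotate3 zero                   = 1
rotate3 (suc zero)             = 2
rotate3 (suc (suc zero))       = 0
rotate3 (suc (suc (suc t)))    = suc (suc (suc (swapPairs t)))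
rotate3⁻¹ zero                 = 2
rotate3⁻¹ (suc zero)           = 0
rotate3⁻¹ (suc (suc zero))     = 1
rotate3⁻¹ (suc (suc (suc t)))  = suc (suc (suc (swapPairs t)))

rotate3-< : ∀ p {t} → t < suc (suc (suc (twice p))) → rotate3 t < suc (suc (suc (twice p)))
rotate3-< p {zero}              _                      = s<s z<s
rotate3-< p {suc zero}          _                      = s<s (s<s z<s)
rotate3-< p {suc (suc zero)}    _                      = z<s
rotate3-< p {suc (suc (suc t))} (s<s (s<s (s<s t<2p))) = s<s (s<s (s<s (swapPairs-< p t<2p)))

rotate3⁻¹-< : ∀ p {t} → t < suc (suc (suc (twice p))) → rotate3⁻¹ t < suc (suc (suc (twice p)))
rotate3⁻¹-< p {zero}              _                      = s<s (s<s z<s)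
rotate3⁻¹-< p {suc zero}          _                      = z<s
rotate3⁻¹-< p {suc (suc zero)}    _                      = s<s z<s
rotate3⁻¹-< p {suc (suc (suc t))} (s<s (s<s (s<s t<2p))) = s<s (s<s (s<s (swapPairs-< p t<2p)))

rotate3-inverseˡ : ∀ t → rotate3 (rotate3⁻¹ t) ≡ t
rotate3-inverseˡ zero                = refl
rotate3-inverseˡ (suc zero)          = refl
rotate3-inverseˡ (suc (suc zero))    = refl
rotate3-inverseˡ (suc (suc (suc t))) = cong (λ x → suc (suc (suc x))) (swapPairs-involutive t)

rotate3-inverseʳ : ∀ t → rotate3⁻¹ (rotate3 t) ≡ t
rotate3-inverseʳ zero                = refl
rotate3-inverseʳ (suc zero)          = refl
rotate3-inverseʳ (suc (suc zero))    = refl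
rotate3-inverseʳ (suc (suc (suc t))) = cong (λ x → suc (suc (suc x))) (swapPairs-involutive t)

rotate3-moves : ∀ t → Move t (rotate3 t)
rotate3-moves zero                = up refl
rotate3-moves (suc zero)          = up refl
rotate3-moves (suc (suc zero))    = wrap refl refl
rotate3-moves (suc (suc (suc t))) with swapPairs-adjacent t
... | inj₁ eq = up   (cong (λ x → suc (suc (suc x))) eq)
... | inj₂ eq = down (cong (λ x → suc (suc (suc x))) eq)

parity : ∀ s → Σ ℕ (λ p → s ≡ twice p) ⊎ Σ ℕ (λ p → s ≡ suc (twice p))
parity zero    = inj₁ (0 , refl)
parity (suc s) with parity s
... | inj₁ (p , eq) = inj₂ (p , cong suc eq)
... | inj₂ (p , eq) = inj₁ (suc p , cong suc eq)

derangement : ∀ s → s ≢ 1 → Derangement s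
derangement s s≢1 with parity s
... | inj₁ (p , refl) = record
  { perm  = record { π = swapPairs ; π⁻¹ = swapPairs
                   ; π-π⁻¹ = swapPairs-involutive ; π⁻¹-π = swapPairs-involutive
                   ; π-< = swapPairs-< p ; π⁻¹-< = swapPairs-< p }
  ; moves = λ t → [ up , down ]′ (swapPairs-adjacent t) }
... | inj₂ (zero , refl)  = ⊥-elim (s≢1 refl)
... | inj₂ (suc p , refl) = record
  { perm  = record { π = rotate3 ; π⁻¹ = rotate3⁻¹
                   ; π-π⁻¹ = rotate3-inverseˡ ; π⁻¹-π = rotate3-inverseʳ
                   ; π-< = rotate3-< p ; π⁻¹-< = rotate3⁻¹-< p }
  ; moves = rotate3-moves }

shiftBy : ℕ → (ℕ → ℕ) → ℕ → ℕ
shiftBy r f u with u <? r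
... | yes _ = u
... | no  _ = r + f (u ∸ r)

shiftBy-below : ∀ r f {u} → u < r → shiftBy r f u ≡ u
shiftBy-below r f {u} u<r with u <? r
... | yes _   = refl
... | no  u≮r = ⊥-elim (u≮r u<r)

shiftBy-above : ∀ r f t → shiftBy r f (r + t) ≡ r + f t
shiftBy-above r f t with r + t <? r
... | yes r+t<r = ⊥-elim (m+n≮m r t r+t<r)
... | no  _     = cong (λ x → r + f x) (m+n∸m≡n r t)

split : ∀ r u → u < r ⊎ Σ ℕ (λ t → u ≡ r + t)
split r u with u <? r
... | yes u<r = inj₁ u<r
... | no  u≮r = inj₂ (u ∸ r , sym (m+[n∸m]≡n (≮⇒≥ u≮r)))

shift : ∀ r {s N} → r + s ≡ N → PermBelow s → PermBelow N
shift r {s} {N} r+s≡N P = record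
  { π     = shiftBy r π
  ; π⁻¹   = shiftBy r π⁻¹
  ; π-π⁻¹ = shiftBy-inverse π π⁻¹ π-π⁻¹
  ; π⁻¹-π = shiftBy-inverse π⁻¹ π π⁻¹-π
  ; π-<   = shiftBy-< π π-<
  ; π⁻¹-< = shiftBy-< π⁻¹ π⁻¹-< }
  where
    open PermBelow P
    shiftBy-inverse : ∀ f g → (∀ t → f (g t) ≡ t) → ∀ u → shiftBy r f (shiftBy r g u) ≡ u
    shiftBy-inverse f g f∘g≡id u with split r u
    ... | inj₁ u<r = trans (cong (shiftBy r f) (shiftBy-below r g u<r)) (shiftBy-below r f u<r)
    ... | inj₂ (t , refl) = begin
      shiftBy r f (shiftBy r g (r + t)) ≡⟨ cong (shiftBy r f) (shiftBy-above r g t) ⟩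
      shiftBy r f (r + g t)             ≡⟨ shiftBy-above r f (g t) ⟩
      r + f (g t)                       ≡⟨ cong (r +_) (f∘g≡id t) ⟩
      r + t                             ∎
    shiftBy-< : ∀ f → (∀ {t} → t < s → f t < s) → ∀ {u} → u < N → shiftBy r f u < N
    shiftBy-< f f-< {u} u<N with split r u
    ... | inj₁ u<r = subst (_< N) (sym (shiftBy-below r f u<r)) (<-≤-trans u<r (subst (r ≤_) r+s≡N (m≤m+n r s)))
    ... | inj₂ (t , refl) = subst (_< N) (sym (shiftBy-above r f t)) (subst (r + f t <_) r+s≡N
      (+-monoʳ-< r (f-< (+-cancelˡ-< r t s (subst (r + t <_) (sym r+s≡N) u<N)))))

-- The construction for n = R + 4 parts of size q², q = 2^(k+1), in which the
-- factors j < r have total voltage 0 and the others total voltage of order q.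
module Construction (k R r : ℕ) (r≤h : r ≤ 2 ^ suc k * 2 ^ suc k)
                    (r≢h∸1 : r ≢ 2 ^ suc k * 2 ^ suc k ∸ 1) where
  open Coordinates k
  open AbGroupFacts 𝔾

  n h s : ℕ
  n = suc (suc (suc (suc R)))
  h = q * q
  s = h ∸ r

  instance
    h≢0 : NonZero h
    h≢0 = m*n≢0 q q

  open Voltage {n} {h} 𝔾

  r+s≡h : r + s ≡ h
  r+s≡h = m+[n∸m]≡n r≤h

  s≢1 : s ≢ 1
  s≢1 s≡1 = r≢h∸1 (begin
    r          ≡⟨ m+n∸n≡m r 1 ⟨
    r + 1 ∸ 1  ≡⟨ cong (λ x → r + x ∸ 1) s≡1 ⟨
    r + s ∸ 1  ≡⟨ cong (_∸ 1) r+s≡h ⟩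
    h ∸ 1      ∎)

  2≤q : 2 ≤ q
  2≤q = *-monoʳ-≤ 2 (m^n>0 2 k)

  q<h : q < h
  q<h = m<m*n q q 2≤q

  module D = Derangement (derangement s s≢1)
  open PermBelow D.perm using (π)

  τ : Fin h ↔ Fin h
  τ = PermBelow.onFin (shift r r+s≡h D.perm)

  τ-below : ∀ j → toℕ j < r → Inverse.to τ j ≡ j
  τ-below j j<r = toℕ-injective (trans (PermBelow.toℕ-onFin (shift r r+s≡h D.perm) j) (shiftBy-below r π j<r))

  τ-above : ∀ j t → toℕ j ≡ r + t → toℕ (Inverse.to τ j) ≡ r + π t
  τ-above j t j≡r+t = begin
    toℕ (Inverse.to τ j)   ≡⟨ PermBelow.toℕ-onFin (shift r r+s≡h D.perm) j ⟩
    shiftBy r π (toℕ j)    ≡⟨ cong (shiftBy r π) j≡r+t ⟩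
    shiftBy r π (r + t)    ≡⟨ shiftBy-above r π t ⟩
    r + π t                ∎

  -- g is the translation j ↦ j + C of ℤ/h, chosen so that g r = q - 2 and g (r + 2) = q.
  private
    module ℤh = ZMod h
    module ℤhG = AbGroupFacts ℤh.abGroup

  C : ℕ
  C = s + (q ∸ 2)

  g : Fin h ↔ Fin h
  g = ℤhG.translation ℤh.⟦ C ⟧

  ĝ : Fin h → Fin h
  ĝ = Inverse.to g

  toℕ-g : ∀ j → toℕ (ĝ j) ≡ (toℕ j + C) % h
  toℕ-g j = begin
    toℕ (j ℤh.⊕ ℤh.⟦ C ⟧)            ≡⟨ cong (λ i → toℕ (i ℤh.⊕ ℤh.⟦ C ⟧)) (ℤh.⟦toℕ⟧ j) ⟨
    toℕ (ℤh.⟦ toℕ j ⟧ ℤh.⊕ ℤh.⟦ C ⟧) ≡⟨ cong toℕ (ℤh.⟦+⟧ (toℕ j) C) ⟩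
    toℕ ℤh.⟦ toℕ j + C ⟧             ≡⟨ ℤh.toℕ-⟦⟧ (toℕ j + C) ⟩
    (toℕ j + C) % h                  ∎

  g-adjacent : ∀ j j' → toℕ j' ≡ suc (toℕ j) → toℕ (ĝ j) % 2 ≢ toℕ (ĝ j') % 2
  g-adjacent j j' j'≡j+1 same = suc-flips-parity (toℕ j + C) (begin
    suc (toℕ j + C) % 2     ≡⟨ cong (λ x → (x + C) % 2) j'≡j+1 ⟨
    (toℕ j' + C) % 2        ≡⟨ g-parity j' ⟨
    toℕ (ĝ j') % 2          ≡⟨ same ⟨
    toℕ (ĝ j) % 2           ≡⟨ g-parity j ⟩
    (toℕ j + C) % 2         ∎)
    where
      g-parity : ∀ i → toℕ (ĝ i) % 2 ≡ (toℕ i + C) % 2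
      g-parity i = trans (cong (_% 2) (toℕ-g i)) (m∣n⇒o%n%m≡o%m 2 h _ (∣-trans 2∣q (m∣m*n q)))

  g-above : ∀ j e → toℕ j ≡ r + e → toℕ (ĝ j) ≡ (q ∸ 2 + e) % h
  g-above j e j≡r+e = begin
    toℕ (ĝ j)                     ≡⟨ toℕ-g j ⟩
    (toℕ j + C) % h               ≡⟨ cong (λ x → (x + C) % h) j≡r+e ⟩
    (r + e + (s + (q ∸ 2))) % h   ≡⟨ cong (_% h) (rearrange r e s (q ∸ 2)) ⟩
    (q ∸ 2 + e + (r + s)) % h     ≡⟨ cong (λ x → (q ∸ 2 + e + x) % h) r+s≡h ⟩
    (q ∸ 2 + e + h) % h           ≡⟨ [m+n]%n≡m%n (q ∸ 2 + e) h ⟩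
    (q ∸ 2 + e) % h               ∎
    where
      rearrange : ∀ a b c d → a + b + (c + d) ≡ d + b + (a + c)
      rearrange = solve-∀

  x-of-g : ∀ j → toℕ j ≡ r → x-of (ĝ j) ≡ 0
  x-of-g j j≡r = begin
    x-of (ĝ j)               ≡⟨ x-quotient (ĝ j) ⟩
    toℕ (ĝ j) / q            ≡⟨ cong (_/ q) (g-above j 0 (trans j≡r (sym (+-identityʳ r)))) ⟩
    (q ∸ 2 + 0) % h / q      ≡⟨ cong (λ x → x % h / q) (+-identityʳ (q ∸ 2)) ⟩
    (q ∸ 2) % h / q          ≡⟨ cong (_/ q) (m<n⇒m%n≡m (<-trans q∸2<q q<h)) ⟩
    (q ∸ 2) / q              ≡⟨ m<n⇒m/n≡0 q∸2<q ⟩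
    0                        ∎
    where q∸2<q = ∸-monoʳ-< {q} {2} {0} z<s 2≤q

  x-of-g+2 : ∀ j → toℕ j ≡ r + 2 → x-of (ĝ j) ≡ 1
  x-of-g+2 j j≡r+2 = begin
    x-of (ĝ j)               ≡⟨ x-quotient (ĝ j) ⟩
    toℕ (ĝ j) / q            ≡⟨ cong (_/ q) (g-above j 2 j≡r+2) ⟩
    (q ∸ 2 + 2) % h / q      ≡⟨ cong (λ x → x % h / q) (m∸n+n≡m 2≤q) ⟩
    q % h / q                ≡⟨ cong (_/ q) (m<n⇒m%n≡m q<h) ⟩
    q / q                    ≡⟨ n/n≡1 q ⟩
    1                        ∎

  tailColumn : ℕ → ℕ → Fin h ↔ Fin h
  tailColumn 3             1             = ψ̂-bijection ↔-∘ g
  tailColumn 3             2             = ψ̂-bijection ↔-∘ (ψ̂-bijection ↔-∘ g)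
  tailColumn (suc (suc _)) 1             = negation ↔-∘ g
  tailColumn (suc (suc m)) (suc (suc u)) = tailColumn m u
  tailColumn _             _             = g

  tail-sum : ∀ m j → Σ< (λ u → Inverse.to (tailColumn (suc (suc m)) u) j) (suc (suc m)) ≡ ε
  tail-sum zero          j = trans (cong (ĝ j ∙_) (identityʳ _)) (inverseʳ (ĝ j))
  tail-sum (suc zero)    j = trans (cong (λ x → ĝ j ∙ (ψ̂ (ĝ j) ∙ x)) (identityʳ _)) (ψ̂-sum (ĝ j))
  tail-sum (suc (suc m)) j = trans (cong (λ x → ĝ j ∙ (ĝ j ⁻¹ ∙ x)) (tail-sum m j))
                                   (trans (cong (ĝ j ∙_) (identityʳ _)) (inverseʳ (ĝ j)))

  column : ℕ → Fin h ↔ Fin h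
  column zero          = g
  column (suc zero)    = negation ↔-∘ (g ↔-∘ τ)
  column (suc (suc u)) = tailColumn (suc (suc R)) u

  difference : Fin h → Fin h
  difference j = ĝ j ∙ ĝ (Inverse.to τ j) ⁻¹

  total-column : ∀ j → total (λ i → Inverse.to (column (toℕ i)) j) ≡ difference j
  total-column j = begin
    total (λ i → Inverse.to (column (toℕ i)) j)            ≡⟨ total-Σ (λ u → Inverse.to (column u) j) ⟩
    ĝ j ∙ (ĝ (Inverse.to τ j) ⁻¹ ∙ Σ< (λ u → Inverse.to (tailColumn (suc (suc R)) u) j) (suc (suc R)))
                                                          ≡⟨ cong (λ x → ĝ j ∙ (ĝ (Inverse.to τ j) ⁻¹ ∙ x)) (tail-sum R j) ⟩
    ĝ j ∙ (ĝ (Inverse.to τ j) ⁻¹ ∙ ε)                      ≡⟨ cong (ĝ j ∙_) (identityʳ _) ⟩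
    difference j                                           ∎

  L len : Fin h → ℕ
  L   j = if ⌊ toℕ j <? r ⌋ then 1 else q
  len j = if ⌊ toℕ j <? r ⌋ then n else n * q

  len≡L*n : ∀ j → len j ≡ L j * n
  len≡L*n j with toℕ j <? r
  ... | yes _ = sym (+-identityʳ n)
  ... | no  _ = *-comm n q

  L-cases : ∀ j → (toℕ j < r × L j ≡ 1) ⊎ (¬ toℕ j < r × L j ≡ q)
  L-cases j with toℕ j <? r
  ... | yes j<r = inj₁ (j<r , refl)
  ... | no  j≮r = inj₂ (j≮r , refl)

  difference-below : ∀ j → toℕ j < r → difference j ≡ ε
  difference-below j j<r = trans (cong (λ i → ĝ j ∙ ĝ i ⁻¹) (τ-below j j<r)) (inverseʳ (ĝ j))

  difference-above : ∀ j t → toℕ j ≡ r + t → OddCoordinate (difference j)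
  difference-above j t j≡r+t = by-move (D.moves t)
    where
      τj : Fin h
      τj = Inverse.to τ j
      τj≡r+πt : toℕ τj ≡ r + π t
      τj≡r+πt = τ-above j t j≡r+t
      by-move : Move t (π t) → OddCoordinate (ĝ j ∙ ĝ τj ⁻¹)
      by-move (up πt≡t+1) = parity-differs (ĝ j) (ĝ τj) (g-adjacent j τj (begin
        toℕ τj                ≡⟨ τj≡r+πt ⟩
        r + π t               ≡⟨ cong (r +_) πt≡t+1 ⟩
        r + suc t             ≡⟨ +-suc r t ⟩
        suc (r + t)           ≡⟨ cong suc j≡r+t ⟨
        suc (toℕ j)           ∎))
      by-move (down t≡πt+1) = parity-differs (ĝ j) (ĝ τj) (λ eq → g-adjacent τj j (begin
        toℕ j                 ≡⟨ j≡r+t ⟩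
        r + t                 ≡⟨ cong (r +_) t≡πt+1 ⟩
        r + suc (π t)         ≡⟨ +-suc r (π t) ⟩
        suc (r + π t)         ≡⟨ cong suc τj≡r+πt ⟨
        suc (toℕ τj)          ∎) (sym eq))
      by-move (wrap t≡2 πt≡0) = x-parity-differs (ĝ j) (ĝ τj) (λ eq → 1≢0 (begin
        1                     ≡⟨ cong (_% 2) (x-of-g+2 j (trans j≡r+t (cong (r +_) t≡2))) ⟨
        x-of (ĝ j) % 2        ≡⟨ eq ⟩
        x-of (ĝ τj) % 2       ≡⟨ cong (_% 2) (x-of-g τj (trans τj≡r+πt (trans (cong (r +_) πt≡0) (+-identityʳ r)))) ⟩
        0                     ∎))
        where
          1≢0 : 1 ≢ 0
          1≢0 ()

  difference-order : ∀ j → HasOrder (L j) (difference j)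
  difference-order j = by-cases (L-cases j)
    where
      by-cases : (toℕ j < r × L j ≡ 1) ⊎ (¬ toℕ j < r × L j ≡ q) → HasOrder (L j) (difference j)
      by-cases (inj₁ (j<r , L≡1)) = subst₂ HasOrder (sym L≡1) (sym (difference-below j j<r))
                                      (identityʳ ε , λ { (suc _) _ (s<s ()) })
      by-cases (inj₂ (j≮r , L≡q)) = subst (λ x → HasOrder x (difference j)) (sym L≡q)
                                      (oddCoordinate⇒order (difference j)
                                        (difference-above j (toℕ j ∸ r) (sym (m+[n∸m]≡n (≮⇒≥ j≮r)))))

  decomposition : Σ ((j : Fin h) → CycleFactor n h (len j)) (IsDecomposition len)
  decomposition = voltageDecomposition (column ∘ toℕ) len L len≡L*n
    (λ j → subst (HasOrder (L j)) (sym (total-column j)) (difference-order j))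

4^m≡2^m*2^m : ∀ m → 4 ^ m ≡ 2 ^ m * 2 ^ m
4^m≡2^m*2^m m = begin
  4 ^ m          ≡⟨ ^-*-assoc 2 2 m ⟩
  2 ^ (2 * m)    ≡⟨ cong (λ e → 2 ^ (m + e)) (+-identityʳ m) ⟩
  2 ^ (m + m)    ≡⟨ ^-distribˡ-+-* 2 m m ⟩
  2 ^ m * 2 ^ m  ∎

theorem3p5 : (k n r : ℕ) → 1 ≤ k → 5 ≤ n → r ≤ 4 ^ k → r ≢ 4 ^ k ∸ 1 →
    Σ ((j : Fin (4 ^ k)) → CycleFactor n (4 ^ k) (if ⌊ toℕ j <? r ⌋ then n else n * 2 ^ k))
      (λ F → IsDecomposition (λ j → if ⌊ toℕ j <? r ⌋ then n else n * 2 ^ k) F)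
theorem3p5 zero    _ _ () _ _ _
theorem3p5 (suc k) n@(suc (suc (suc (suc (suc R))))) r _ (s≤s (s≤s (s≤s (s≤s (s≤s _))))) r≤4^k r≢4^k∸1 =
  subst Decomposition (sym 4^k≡q²)
    (Construction.decomposition k (suc R) r (subst (r ≤_) 4^k≡q² r≤4^k)
                                            (subst (λ N → r ≢ N ∸ 1) 4^k≡q² r≢4^k∸1))
  where
    4^k≡q² : 4 ^ suc k ≡ 2 ^ suc k * 2 ^ suc k
    4^k≡q² = 4^m≡2^m*2^m (suc k)

    Decomposition : ℕ → Set
    Decomposition N =
      let len = λ (j : Fin N) → if ⌊ toℕ j <? r ⌋ then n else n * 2 ^ suc k
      in Σ ((j : Fin N) → CycleFactor n N (len j)) (IsDecomposition len)
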